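{- Let $A=x^a(x+1)^bP^c\in\mathbb{F}_2[x]$ with $a,b,c$ positive integers and $P$ an odd irreducible polynomial, and suppose $A$ is bi-unitary perfect. Then $\sigma^{**}(x^a(x+1)^b)$ does not split over $\mathbb{F}_2$; consequently $a\ge3$ or $b\ge3$, and it is not the case that $a=2^n-1$ and $b=2^m-1$ for some integers $n,m\ge1$.
   Context: $S\in\mathbb{F}_2[x]$ is odd if $\gcd(S,x(x+1))=1$. A divisor $D$ of nonzero $S$ is unitary if $\gcd(D,S/D)=1$; $\gcd_u(S,U)$ is the greatest common unitary divisor; $D$ is a bi-unitary divisor of $S$ if $\gcd_u(D,S/D)=1$; $\sigma^{**}(S)$ is the sum of all bi-unitary divisors of $S$; $S$ is bi-unitary perfect if $\sigma^{**}(S)=S$. A polynomial splits over $\mathbb{F}_2$ if it is a product of polynomials of degree $1$. -}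

module Defs where

open import Data.Bool using (Bool; true; false; not; _∧_; _∨_; _xor_; if_then_else_)
open import Data.Nat using (ℕ; zero; suc)
open import Data.List using (List; []; _∷_)
open import Data.List.Membership.Propositional using (_∈_)
open import Data.List.Relation.Unary.All using (All)
open import Data.Product using (Σ; _×_)
open import Data.Sum using (_⊎_)
open import Relation.Binary.PropositionalEquality using (_≡_)
open import Relation.Nullary using (¬_)

-- Polynomials over F₂ in canonical form (so that _≡_ is polynomial equality).
-- A nonzero polynomial is a list of coefficients, lowest degree first,
-- ending in a leading coefficient 1.

data Poly⁺ : Set where
  1p   : Poly⁺
  _∷⁺_ : Bool → Poly⁺ → Poly⁺       -- b ∷⁺ p  =  b + x·p

data F2[x] : Set where
  0p : F2[x]
  nz : Poly⁺ → F2[x]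

cons : Bool → F2[x] → F2[x]
cons false 0p     = 0p
cons true  0p     = nz 1p
cons b     (nz p) = nz (b ∷⁺ p)

one : F2[x]
one = nz 1p

X : F2[x]
X = nz (false ∷⁺ 1p)

X+1 : F2[x]
X+1 = nz (true ∷⁺ 1p)

addP : Poly⁺ → Poly⁺ → F2[x]
addP 1p       1p       = 0p
addP 1p       (b ∷⁺ q) = nz (not b ∷⁺ q)
addP (b ∷⁺ p) 1p       = nz (not b ∷⁺ p)
addP (b ∷⁺ p) (c ∷⁺ q) = cons (b xor c) (addP p q)

infixl 6 _+_
infixl 7 _*_
infixr 8 _^_

_+_ : F2[x] → F2[x] → F2[x]
0p   + q    = q
nz p + 0p   = nz p
nz p + nz q = addP p q

mulP : Poly⁺ → F2[x] → F2[x]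
mulP 1p       q = q
mulP (b ∷⁺ p) q = (if b then q else 0p) + cons false (mulP p q)

_*_ : F2[x] → F2[x] → F2[x]
0p   * q = 0p
nz p * q = mulP p q

_^_ : F2[x] → ℕ → F2[x]
p ^ zero  = one
p ^ suc n = p * p ^ n

-- degree (convention: deg 0 = 0; only used on nonzero polynomials)
deg⁺ : Poly⁺ → ℕ
deg⁺ 1p       = 0
deg⁺ (_ ∷⁺ p) = suc (deg⁺ p)

deg : F2[x] → ℕ
deg 0p     = 0
deg (nz p) = deg⁺ p

_∣_ : F2[x] → F2[x] → Set
D ∣ S = Σ F2[x] (λ Q → D * Q ≡ S)

-- gcd(A,B) = 1 : every common divisor is 1 (the only unit of F₂[x]).
Coprime : F2[x] → F2[x] → Set
Coprime A B = ∀ E → E ∣ A → E ∣ B → E ≡ one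

Odd : F2[x] → Set
Odd S = Coprime S (X * X+1)

Irreducible : F2[x] → Set
Irreducible P = (¬ (deg P ≡ 0)) × (∀ D → D ∣ P → (D ≡ one) ⊎ (D ≡ P))

prod : List F2[x] → F2[x]
prod []       = one
prod (p ∷ ps) = p * prod ps

Splits : F2[x] → Set
Splits T = Σ (List F2[x]) (λ L → All (λ D → deg D ≡ 1) L × prod L ≡ T)

_==⁺_ : Poly⁺ → Poly⁺ → Bool
1p       ==⁺ 1p       = true
(b ∷⁺ p) ==⁺ (c ∷⁺ q) = (if b then c else not c) ∧ (p ==⁺ q)
_        ==⁺ _        = false

infix 4 _==_
_==_ : F2[x] → F2[x] → Bool
0p   == 0p   = true
nz p == nz q = p ==⁺ q
_    == _    = false

anyL : {A : Set} → (A → Bool) → List A → Bool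
anyL f []       = false
anyL f (a ∷ as) = f a ∨ anyL f as

allL : {A : Set} → (A → Bool) → List A → Bool
allL f []       = true
allL f (a ∷ as) = f a ∧ allL f as

filterL : {A : Set} → (A → Bool) → List A → List A
filterL f []       = []
filterL f (a ∷ as) = if f a then a ∷ filterL f as else filterL f as

concatL : {A : Set} → List (List A) → List A
concatL []         = []
concatL ([] ∷ xss) = concatL xss
concatL ((x ∷ xs) ∷ xss) = x ∷ concatL (xs ∷ xss)

mapL : {A B : Set} → (A → B) → List A → List B
mapL f []       = []
mapL f (a ∷ as) = f a ∷ mapL f as

sumP : List F2[x] → F2[x]
sumP []       = 0p
sumP (p ∷ ps) = p + sumP ps

-- all polynomials of degree < n (each exactly once; 0 included)
polys< : ℕ → List F2[x]
polys< zero    = 0p ∷ []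
polys< (suc n) = concatL (mapL (λ p → cons false p ∷ cons true p ∷ []) (polys< n))

polys≤ : ℕ → List F2[x]
polys≤ d = polys< (suc d)

-- For nonzero arguments all divisors / cofactors have degree bounded
-- by the degree of the polynomial being divided, so the searches are exact.
divides? : F2[x] → F2[x] → Bool
divides? D S = anyL (λ Q → D * Q == S) (polys≤ (deg S))

coprime? : F2[x] → F2[x] → Bool
coprime? A B = allL (λ F → not (divides? F A ∧ divides? F B) ∨ (F == one)) (polys≤ (deg A))

unitary? : F2[x] → F2[x] → Bool
unitary? E D = anyL (λ R → (E * R == D) ∧ coprime? E R) (polys≤ (deg D))

gcdu1? : F2[x] → F2[x] → Bool
gcdu1? D Q = allL (λ E → not (unitary? E D ∧ unitary? E Q) ∨ (E == one)) (polys≤ (deg D))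

biunitary? : F2[x] → F2[x] → Bool
biunitary? D S = anyL (λ Q → (D * Q == S) ∧ gcdu1? D Q) (polys≤ (deg S))

-- σ**(S) : sum of all bi-unitary divisors of S (S nonzero)
σ** : F2[x] → F2[x]
σ** S = sumP (filterL (λ D → not (D == 0p) ∧ biunitary? D S) (polys≤ (deg S)))

BiUnitaryPerfect : F2[x] → Set
BiUnitaryPerfect S = σ** S ≡ S

-- Write B = x^a (x+1)^b.  A bi-unitary divisor of B P^c prime to P is the same thing as a
-- bi-unitary divisor of B, so σ**(B P^c) and σ**(B) differ by a sum of multiples of P.
-- Since σ**(B P^c) = B P^c, the odd irreducible P divides σ**(B); being neither x nor x + 1,
-- P divides no product of linear polynomials, so σ**(B) does not split.
-- But σ**(B) does split when a, b ≤ 2 (by evaluation) and when a = 2ⁿ - 1, b = 2ᵐ - 1: then a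
-- and b are odd, every divisor xⁱ(x+1)ʲ of B is bi-unitary, and
-- σ**(B) = (1 + x + ⋯ + xᵃ)(1 + (x+1) + ⋯ + (x+1)ᵇ) = (x+1)ᵃ xᵇ since (1 + y)^(2ⁿ) = 1 + y^(2ⁿ).

module Submission where

open import Defs
open import Algebra.Bundles using (CommutativeSemigroup)
import Algebra.Properties.CommutativeSemigroup as CommutativeSemigroupProperties
open import Data.Bool using (Bool; true; false; not; _∧_; _∨_; _xor_; if_then_else_; T)
open import Data.Bool.Properties using (xor-comm; xor-assoc; xor-same; T-∧)
open import Data.Empty using (⊥-elim)
open import Data.List using (List; []; _∷_; _++_; map; filter; cartesianProductWith; downFrom)
open import Data.List.Membership.Propositional using (_∈_)
open import Data.List.Membership.Propositional.Properties
  using (∈-filter⁺; ∈-filter⁻; ∈-cartesianProductWith⁺; ∈-cartesianProductWith⁻; ∈-downFrom⁺; ∈-downFrom⁻)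
open import Data.List.Membership.Propositional.Properties.WithK using (unique∧set⇒bag)
open import Data.List.Relation.Binary.BagAndSetEquality using (_∼[_]_; set; ∼bag⇒↭)
open import Data.List.Relation.Binary.Permutation.Propositional as ↭ using (_↭_)
open import Data.List.Relation.Unary.All using (All; []; _∷_)
import Data.List.Relation.Unary.All.Properties as All
open import Data.List.Relation.Unary.AllPairs using ([]; _∷_)
open import Data.List.Relation.Unary.Any using (here; there)
open import Data.List.Relation.Unary.Unique.Propositional using (Unique)
import Data.List.Relation.Unary.Unique.Propositional.Properties as Unique
open import Data.Nat using (ℕ; zero; suc; _≤_; _<_; _∸_; z≤n; s≤s) renaming (_^_ to _^ℕ_)
import Data.Nat as ℕ
open import Data.Nat.Induction using (<-wellFounded)
import Data.Nat.Properties as ℕₚ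
open import Data.Product using (Σ; _×_; _,_; proj₁; proj₂; ∃)
open import Data.Sum using (_⊎_; inj₁; inj₂)
open import Function.Base using (_∘_)
open import Function.Bundles using (_⇔_; mk⇔; Equivalence)
open import Induction.WellFounded using (Acc; acc)
open import Relation.Binary.PropositionalEquality
  using (_≡_; refl; sym; trans; cong; cong₂; subst; isMagma; module ≡-Reasoning)
open import Relation.Nullary using (¬_; yes; no)
open import Relation.Nullary.Decidable using (T?)

-- The ring F₂[x]

coeff₀ : F2[x] → Bool
coeff₀ 0p            = false
coeff₀ (nz 1p)       = true
coeff₀ (nz (b ∷⁺ p)) = b

quotX : F2[x] → F2[x]
quotX 0p            = 0p
quotX (nz 1p)       = 0p
quotX (nz (_ ∷⁺ p)) = nz p

cons-coeff₀-quotX : ∀ p → cons (coeff₀ p) (quotX p) ≡ p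
cons-coeff₀-quotX 0p                = refl
cons-coeff₀-quotX (nz 1p)           = refl
cons-coeff₀-quotX (nz (false ∷⁺ p)) = refl
cons-coeff₀-quotX (nz (true ∷⁺ p))  = refl

cons-induction : (C : F2[x] → Set) → C 0p → (∀ b p → C p → C (cons b p)) → ∀ p → C p
cons-induction C c0 step 0p                = c0
cons-induction C c0 step (nz 1p)           = step true 0p c0
cons-induction C c0 step (nz (false ∷⁺ p)) = step false (nz p) (cons-induction C c0 step (nz p))
cons-induction C c0 step (nz (true ∷⁺ p))  = step true (nz p) (cons-induction C c0 step (nz p))

cons-cases : (C : F2[x] → Set) → (∀ b p → C (cons b p)) → ∀ p → C p
cons-cases C h p = subst C (cons-coeff₀-quotX p) (h (coeff₀ p) (quotX p))

quotX-cons : ∀ b p → quotX (cons b p) ≡ p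
quotX-cons false 0p     = refl
quotX-cons true  0p     = refl
quotX-cons false (nz p) = refl
quotX-cons true  (nz p) = refl

coeff₀-cons : ∀ b p → coeff₀ (cons b p) ≡ b
coeff₀-cons false 0p     = refl
coeff₀-cons true  0p     = refl
coeff₀-cons false (nz p) = refl
coeff₀-cons true  (nz p) = refl

cons-injective : ∀ {b c p q} → cons b p ≡ cons c q → p ≡ q × b ≡ c
cons-injective {b} {c} {p} {q} e =
  trans (sym (quotX-cons b p)) (trans (cong quotX e) (quotX-cons c q)) ,
  trans (sym (coeff₀-cons b p)) (trans (cong coeff₀ e) (coeff₀-cons c q))

+-identityʳ : ∀ p → p + 0p ≡ p
+-identityʳ 0p     = refl
+-identityʳ (nz p) = refl

+-cons : ∀ b p c q → cons b p + cons c q ≡ cons (b xor c) (p + q)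
+-cons false 0p     false 0p     = refl
+-cons false 0p     true  0p     = refl
+-cons true  0p     false 0p     = refl
+-cons true  0p     true  0p     = refl
+-cons false 0p     false (nz q) = refl
+-cons true  0p     false (nz q) = refl
+-cons false 0p     true  (nz q) = refl
+-cons true  0p     true  (nz q) = refl
+-cons false (nz p) false 0p     = refl
+-cons true  (nz p) false 0p     = refl
+-cons false (nz p) true  0p     = refl
+-cons true  (nz p) true  0p     = refl
+-cons false (nz p) false (nz q) = refl
+-cons false (nz p) true  (nz q) = refl
+-cons true  (nz p) false (nz q) = refl
+-cons true  (nz p) true  (nz q) = refl

+-comm : ∀ p q → p + q ≡ q + p
+-comm = cons-induction (λ p → ∀ q → p + q ≡ q + p) (λ q → sym (+-identityʳ q))
  (λ b p ih → cons-cases _ λ c q → begin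
    cons b p + cons c q    ≡⟨ +-cons b p c q ⟩
    cons (b xor c) (p + q) ≡⟨ cong₂ cons (xor-comm b c) (ih q) ⟩
    cons (c xor b) (q + p) ≡⟨ +-cons c q b p ⟨
    cons c q + cons b p    ∎)
  where open ≡-Reasoning

+-assoc : ∀ p q r → (p + q) + r ≡ p + (q + r)
+-assoc = cons-induction (λ p → ∀ q r → (p + q) + r ≡ p + (q + r)) (λ q r → refl)
  (λ a p ih → cons-cases _ λ b q → cons-cases _ λ c r → begin
    (cons a p + cons b q) + cons c r      ≡⟨ cong (_+ cons c r) (+-cons a p b q) ⟩
    cons (a xor b) (p + q) + cons c r     ≡⟨ +-cons (a xor b) (p + q) c r ⟩
    cons ((a xor b) xor c) ((p + q) + r)  ≡⟨ cong₂ cons (xor-assoc a b c) (ih q r) ⟩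
    cons (a xor (b xor c)) (p + (q + r))  ≡⟨ +-cons a p (b xor c) (q + r) ⟨
    cons a p + cons (b xor c) (q + r)     ≡⟨ cong (cons a p +_) (+-cons b q c r) ⟨
    cons a p + (cons b q + cons c r)      ∎)
  where open ≡-Reasoning

+-self : ∀ p → p + p ≡ 0p
+-self = cons-induction (λ p → p + p ≡ 0p) refl
  (λ b p ih → trans (+-cons b p b p) (cong₂ cons (xor-same b) ih))

+-cancelˡ : ∀ p q → p + (p + q) ≡ q
+-cancelˡ p q = trans (sym (+-assoc p p q)) (cong (_+ q) (+-self p))

+≡0⇒≡ : ∀ p q → p + q ≡ 0p → p ≡ q
+≡0⇒≡ p q e = trans (sym (+-identityʳ p)) (trans (cong (p +_) (sym e)) (+-cancelˡ p q))

+-commutativeSemigroup : CommutativeSemigroup _ _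
+-commutativeSemigroup = record
  { isCommutativeSemigroup = record
    { isSemigroup = record { isMagma = isMagma _+_ ; assoc = +-assoc }
    ; comm = +-comm } }

open CommutativeSemigroupProperties +-commutativeSemigroup public
  using () renaming (interchange to +-interchange; x∙yz≈y∙xz to +-left-comm)

scale : Bool → F2[x] → F2[x]
scale b q = if b then q else 0p

*-cons : ∀ b p q → cons b p * q ≡ scale b q + cons false (p * q)
*-cons false 0p     q = refl
*-cons true  0p     q = sym (+-identityʳ q)
*-cons false (nz p) q = refl
*-cons true  (nz p) q = refl

cons-false-+ : ∀ p q → cons false (p + q) ≡ cons false p + cons false q
cons-false-+ p q = sym (+-cons false p false q)

cons≡scale+cons-false : ∀ b p → cons b p ≡ scale b one + cons false p
cons≡scale+cons-false false p = refl
cons≡scale+cons-false true  p = sym (+-cons true 0p false p)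

scale-xor : ∀ b c r → scale (b xor c) r ≡ scale b r + scale c r
scale-xor false false r = refl
scale-xor false true  r = refl
scale-xor true  false r = sym (+-identityʳ r)
scale-xor true  true  r = sym (+-self r)

scale-+ : ∀ b p q → scale b (p + q) ≡ scale b p + scale b q
scale-+ false p q = refl
scale-+ true  p q = refl

*-zeroʳ : ∀ p → p * 0p ≡ 0p
*-zeroʳ = cons-induction (λ p → p * 0p ≡ 0p) refl
  (λ b p ih → trans (*-cons b p 0p) (trans (cong (λ z → scale b 0p + cons false z) ih) (scale-zero b)))
  where
  scale-zero : ∀ b → scale b 0p + cons false 0p ≡ 0p
  scale-zero false = refl
  scale-zero true  = refl

*-identityʳ : ∀ p → p * one ≡ p
*-identityʳ = cons-induction (λ p → p * one ≡ p) refl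
  (λ b p ih → trans (*-cons b p one)
    (trans (cong (λ z → scale b one + cons false z) ih) (sym (cons≡scale+cons-false b p))))

*-distribʳ-+ : ∀ p q r → (p + q) * r ≡ p * r + q * r
*-distribʳ-+ = cons-induction (λ p → ∀ q r → (p + q) * r ≡ p * r + q * r) (λ q r → refl)
  (λ b p ih → cons-cases _ λ c q r → begin
    (cons b p + cons c q) * r
      ≡⟨ cong (_* r) (+-cons b p c q) ⟩
    cons (b xor c) (p + q) * r
      ≡⟨ *-cons (b xor c) (p + q) r ⟩
    scale (b xor c) r + cons false ((p + q) * r)
      ≡⟨ cong₂ _+_ (scale-xor b c r) (trans (cong (cons false) (ih q r)) (cons-false-+ (p * r) (q * r))) ⟩
    (scale b r + scale c r) + (cons false (p * r) + cons false (q * r))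
      ≡⟨ +-interchange (scale b r) (scale c r) _ _ ⟩
    (scale b r + cons false (p * r)) + (scale c r + cons false (q * r))
      ≡⟨ cong₂ _+_ (*-cons b p r) (*-cons c q r) ⟨
    cons b p * r + cons c q * r
      ∎)
  where open ≡-Reasoning

*-distribˡ-+ : ∀ r p q → r * (p + q) ≡ r * p + r * q
*-distribˡ-+ = cons-induction (λ r → ∀ p q → r * (p + q) ≡ r * p + r * q) (λ p q → refl)
  (λ b r ih p q → begin
    cons b r * (p + q)
      ≡⟨ *-cons b r (p + q) ⟩
    scale b (p + q) + cons false (r * (p + q))
      ≡⟨ cong₂ _+_ (scale-+ b p q) (trans (cong (cons false) (ih p q)) (cons-false-+ (r * p) (r * q))) ⟩
    (scale b p + scale b q) + (cons false (r * p) + cons false (r * q))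
      ≡⟨ +-interchange (scale b p) (scale b q) _ _ ⟩
    (scale b p + cons false (r * p)) + (scale b q + cons false (r * q))
      ≡⟨ cong₂ _+_ (*-cons b r p) (*-cons b r q) ⟨
    cons b r * p + cons b r * q
      ∎)
  where open ≡-Reasoning

*-cons-false : ∀ q p → q * cons false p ≡ cons false (q * p)
*-cons-false = cons-induction (λ q → ∀ p → q * cons false p ≡ cons false (q * p)) (λ p → refl)
  (λ c q ih p → begin
    cons c q * cons false p                                  ≡⟨ *-cons c q (cons false p) ⟩
    scale c (cons false p) + cons false (q * cons false p)   ≡⟨ cong₂ _+_ (scale-cons-false c p) (cong (cons false) (ih p)) ⟩
    cons false (scale c p) + cons false (cons false (q * p)) ≡⟨ cons-false-+ (scale c p) (cons false (q * p)) ⟨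
    cons false (scale c p + cons false (q * p))              ≡⟨ cong (cons false) (*-cons c q p) ⟨
    cons false (cons c q * p)                                ∎)
  where
  open ≡-Reasoning
  scale-cons-false : ∀ c p → scale c (cons false p) ≡ cons false (scale c p)
  scale-cons-false false p = refl
  scale-cons-false true  p = refl

*-scale-one : ∀ q b → q * scale b one ≡ scale b q
*-scale-one q false = *-zeroʳ q
*-scale-one q true  = *-identityʳ q

*-comm : ∀ p q → p * q ≡ q * p
*-comm = cons-induction (λ p → ∀ q → p * q ≡ q * p) (λ q → sym (*-zeroʳ q))
  (λ b p ih q → begin
    cons b p * q                         ≡⟨ *-cons b p q ⟩
    scale b q + cons false (p * q)       ≡⟨ cong₂ _+_ (sym (*-scale-one q b)) (cong (cons false) (ih q)) ⟩
    q * scale b one + cons false (q * p) ≡⟨ cong (q * scale b one +_) (*-cons-false q p) ⟨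
    q * scale b one + q * cons false p   ≡⟨ *-distribˡ-+ q (scale b one) (cons false p) ⟨
    q * (scale b one + cons false p)     ≡⟨ cong (q *_) (cons≡scale+cons-false b p) ⟨
    q * cons b p                         ∎)
  where open ≡-Reasoning

*-assoc : ∀ p q r → (p * q) * r ≡ p * (q * r)
*-assoc = cons-induction (λ p → ∀ q r → (p * q) * r ≡ p * (q * r)) (λ q r → refl)
  (λ b p ih q r → begin
    (cons b p * q) * r                         ≡⟨ cong (_* r) (*-cons b p q) ⟩
    (scale b q + cons false (p * q)) * r       ≡⟨ *-distribʳ-+ (scale b q) (cons false (p * q)) r ⟩
    scale b q * r + cons false (p * q) * r     ≡⟨ cong₂ _+_ (scale-* b q r) (trans (*-cons false (p * q) r)
                                                                                   (cong (cons false) (ih q r))) ⟩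
    scale b (q * r) + cons false (p * (q * r)) ≡⟨ *-cons b p (q * r) ⟨
    cons b p * (q * r)                         ∎)
  where
  open ≡-Reasoning
  scale-* : ∀ b q r → scale b q * r ≡ scale b (q * r)
  scale-* false q r = refl
  scale-* true  q r = refl

*-commutativeSemigroup : CommutativeSemigroup _ _
*-commutativeSemigroup = record
  { isCommutativeSemigroup = record
    { isSemigroup = record { isMagma = isMagma _*_ ; assoc = *-assoc }
    ; comm = *-comm } }

open CommutativeSemigroupProperties *-commutativeSemigroup public
  using () renaming (interchange to *-interchange)

^-distribˡ-+-* : ∀ p m n → p ^ (m ℕ.+ n) ≡ p ^ m * p ^ n
^-distribˡ-+-* p zero    n = refl
^-distribˡ-+-* p (suc m) n = trans (cong (p *_) (^-distribˡ-+-* p m n)) (sym (*-assoc p (p ^ m) (p ^ n)))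

-- Degree and division with remainder

cons-nz : ∀ b r → cons b (nz r) ≡ nz (b ∷⁺ r)
cons-nz false r = refl
cons-nz true  r = refl

len : F2[x] → ℕ
len 0p     = 0
len (nz p) = suc (deg⁺ p)

addP-deg< : ∀ q s → deg⁺ q < deg⁺ s → Σ Poly⁺ λ r → addP q s ≡ nz r × deg⁺ r ≡ deg⁺ s
addP-deg< 1p       (b ∷⁺ s) _         = not b ∷⁺ s , refl , refl
addP-deg< (b ∷⁺ q) (c ∷⁺ s) (s≤s q<s) with addP-deg< q s q<s
... | r , e , dr rewrite e = (b xor c) ∷⁺ r , cons-nz (b xor c) r , cong suc dr

addP-deg≡ : ∀ q s → deg⁺ q ≡ deg⁺ s → len (addP q s) ≤ deg⁺ s
addP-deg≡ 1p       1p       _ = z≤n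
addP-deg≡ (b ∷⁺ q) (c ∷⁺ s) e =
  ℕₚ.≤-trans (len-cons≤ (b xor c) (addP q s)) (s≤s (addP-deg≡ q s (ℕₚ.suc-injective e)))
  where
  len-cons≤ : ∀ b p → len (cons b p) ≤ suc (len p)
  len-cons≤ false 0p     = z≤n
  len-cons≤ true  0p     = s≤s z≤n
  len-cons≤ b     (nz p) = ℕₚ.≤-reflexive (cong len (cons-nz b p))

*-nz : ∀ p q → Σ Poly⁺ λ r → nz p * nz q ≡ nz r × deg⁺ r ≡ deg⁺ p ℕ.+ deg⁺ q
*-nz 1p       q = q , refl , refl
*-nz (b ∷⁺ p) q with *-nz p q
... | r , e , dr rewrite e = lead b
  where
  lead : ∀ b → Σ Poly⁺ λ r′ → scale b (nz q) + nz (false ∷⁺ r) ≡ nz r′ × deg⁺ r′ ≡ suc (deg⁺ p ℕ.+ deg⁺ q)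
  lead false = false ∷⁺ r , refl , cong suc dr
  lead true with addP-deg< q (false ∷⁺ r) (s≤s (subst (deg⁺ q ≤_) (sym dr) (ℕₚ.m≤n+m (deg⁺ q) (deg⁺ p))))
  ... | r′ , e′ , dr′ = r′ , e′ , trans dr′ (cong suc dr)

*-≡0 : ∀ p q → p * q ≡ 0p → p ≡ 0p ⊎ q ≡ 0p
*-≡0 0p     q      e = inj₁ refl
*-≡0 (nz p) 0p     e = inj₂ refl
*-≡0 (nz p) (nz q) e with *-nz p q
... | r , e′ , _ with trans (sym e′) e
... | ()

*-cancelˡ : ∀ p q r → ¬ p ≡ 0p → p * q ≡ p * r → q ≡ r
*-cancelˡ p q r p≢0 e with *-≡0 p (q + r) (trans (*-distribˡ-+ p q r) (trans (cong (_+ p * r) e) (+-self (p * r))))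
... | inj₁ p≡0   = ⊥-elim (p≢0 p≡0)
... | inj₂ q+r≡0 = +≡0⇒≡ q r q+r≡0

≢0⇒nz : ∀ S → ¬ S ≡ 0p → Σ Poly⁺ λ s → S ≡ nz s
≢0⇒nz 0p     S≢0 = ⊥-elim (S≢0 refl)
≢0⇒nz (nz s) _   = s , refl

*-≢0 : ∀ {p q} → ¬ p ≡ 0p → ¬ q ≡ 0p → ¬ p * q ≡ 0p
*-≢0 {p} {q} p≢0 q≢0 pq≡0 with *-≡0 p q pq≡0
... | inj₁ p≡0 = p≢0 p≡0
... | inj₂ q≡0 = q≢0 q≡0

^-≢0 : ∀ {p} → ¬ p ≡ 0p → ∀ n → ¬ p ^ n ≡ 0p
^-≢0 p≢0 zero    ()
^-≢0 p≢0 (suc n) = *-≢0 p≢0 (^-≢0 p≢0 n)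

*≡nz : ∀ D Q s → D * Q ≡ nz s →
       Σ Poly⁺ λ d → Σ Poly⁺ λ q → D ≡ nz d × Q ≡ nz q × deg⁺ d ℕ.+ deg⁺ q ≡ deg⁺ s
*≡nz 0p     Q      s ()
*≡nz (nz d) 0p     s e with trans (sym (*-zeroʳ (nz d))) e
... | ()
*≡nz (nz d) (nz q) s e with *-nz d q
... | r , e′ , dr with trans (sym e′) e
... | refl = d , q , refl , refl , sym dr

deg⁺≡0⇒≡one : ∀ d → deg⁺ d ≡ 0 → nz d ≡ one
deg⁺≡0⇒≡one 1p _ = refl

X^*-nz : ∀ k d → Σ Poly⁺ λ t → X ^ k * nz d ≡ nz t × deg⁺ t ≡ k ℕ.+ deg⁺ d
X^*-nz zero    d = d , refl , refl
X^*-nz (suc k) d with X^*-nz k d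
... | t , e , dt = false ∷⁺ t , trans (*-assoc X (X ^ k) (nz d)) (cong (X *_) e) , cong suc dt

-- len R ≤ deg d says that R = 0 or deg R < deg d.
divMod : ∀ S d → Σ F2[x] λ Q → Σ F2[x] λ R → S ≡ Q * nz d + R × len R ≤ deg⁺ d
divMod S d = go S (<-wellFounded (len S))
  where
  go : ∀ S → Acc _<_ (len S) → Σ F2[x] λ Q → Σ F2[x] λ R → S ≡ Q * nz d + R × len R ≤ deg⁺ d
  go S _ with len S ℕ.≤? deg⁺ d
  ... | yes short = 0p , S , refl , short
  go 0p     _         | no long = ⊥-elim (long z≤n)
  go (nz s) (acc rec) | no long with X^*-nz (deg⁺ s ∸ deg⁺ d) d
  -- subtracting xᵏ d with k = deg s - deg d cancels the leading term of s
  ... | t , Xᵏd≡t , dt with go (addP s t) (rec (s≤s (subst (len (addP s t) ≤_) dt≡ds (addP-deg≡ s t (sym dt≡ds)))))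
    where
    dt≡ds : deg⁺ t ≡ deg⁺ s
    dt≡ds = trans dt (ℕₚ.m∸n+n≡m (ℕₚ.≤-pred (ℕₚ.≰⇒> long)))
  ... | Q , R , eq , R-short = Q + X ^ k , R , eq′ , R-short
    where
    k : ℕ
    k = deg⁺ s ∸ deg⁺ d
    Xᵏd : F2[x]
    Xᵏd = X ^ k * nz d
    eq′ : nz s ≡ (Q + X ^ k) * nz d + R
    eq′ = begin
      nz s                   ≡⟨ +-cancelˡ Xᵏd (nz s) ⟨
      Xᵏd + (Xᵏd + nz s)     ≡⟨ cong (λ z → Xᵏd + (z + nz s)) Xᵏd≡t ⟩
      Xᵏd + (nz t + nz s)    ≡⟨ cong (Xᵏd +_) (+-comm (nz t) (nz s)) ⟩
      Xᵏd + addP s t         ≡⟨ cong (Xᵏd +_) eq ⟩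
      Xᵏd + (Q * nz d + R)   ≡⟨ +-assoc Xᵏd _ R ⟨
      (Xᵏd + Q * nz d) + R   ≡⟨ cong (_+ R) (+-comm Xᵏd _) ⟩
      (Q * nz d + Xᵏd) + R   ≡⟨ cong (_+ R) (*-distribʳ-+ Q (X ^ k) (nz d)) ⟨
      (Q + X ^ k) * nz d + R ∎
      where open ≡-Reasoning

-- Divisibility and Euclid's lemma

∣-refl : ∀ D → D ∣ D
∣-refl D = one , *-identityʳ D

∣-trans : ∀ D {E F} → D ∣ E → E ∣ F → D ∣ F
∣-trans D (q₁ , e₁) (q₂ , e₂) = q₁ * q₂ , trans (sym (*-assoc D q₁ q₂)) (trans (cong (_* q₂) e₁) e₂)

∣-*ʳ : ∀ D {S} T → D ∣ S → D ∣ (S * T)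
∣-*ʳ D T (q , e) = q * T , trans (sym (*-assoc D q T)) (cong (_* T) e)

∣-*ˡ : ∀ D {T} S → D ∣ T → D ∣ (S * T)
∣-*ˡ D {T} S d = subst (D ∣_) (*-comm T S) (∣-*ʳ D S d)

∣-+ : ∀ D {S T} → D ∣ S → D ∣ T → D ∣ (S + T)
∣-+ D (q₁ , e₁) (q₂ , e₂) = q₁ + q₂ , trans (*-distribˡ-+ D q₁ q₂) (cong₂ _+_ e₁ e₂)

∣-+ʳ : ∀ D {S T} → D ∣ S → D ∣ (S + T) → D ∣ T
∣-+ʳ D {S} {T} d₁ d₂ = subst (D ∣_) (+-cancelˡ S T) (∣-+ D d₁ d₂)

∣-0 : ∀ D → D ∣ 0p
∣-0 D = 0p , *-zeroʳ D

∣-nz : ∀ D {s} → D ∣ nz s → Σ Poly⁺ λ d → D ≡ nz d × deg⁺ d ≤ deg⁺ s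
∣-nz D {s} (Q , e) with *≡nz D Q s e
... | d , q , refl , _ , de = d , refl , subst (deg⁺ d ≤_) de (ℕₚ.m≤m+n (deg⁺ d) (deg⁺ q))

irreducible-nz : ∀ {P} → Irreducible P → Σ Poly⁺ λ p → P ≡ nz p
irreducible-nz {0p}   (deg≢0 , _) = ⊥-elim (deg≢0 refl)
irreducible-nz {nz p} _           = p , refl

irreducible≢0 : ∀ {P} → Irreducible P → ¬ P ≡ 0p
irreducible≢0 P-irr P≡0 = proj₁ P-irr (cong deg P≡0)

irreducible∤one : ∀ {P} → Irreducible P → ¬ P ∣ one
irreducible∤one {P} P-irr (Q , e) with *≡nz P Q 1p e
... | p , _ , refl , _ , de = proj₁ P-irr (ℕₚ.m+n≡0⇒m≡0 (deg⁺ p) de)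

-- Euclid's lemma.  If P ∤ U, the remainder r of U mod P is a nonzero polynomial of
-- smaller degree with P ∣ r V; dividing P by r yields a still smaller one, until r = 1.
irreducible∣rem*⇒∣ : ∀ {P} → Irreducible P → ∀ V r → deg⁺ r < deg P → P ∣ (nz r * V) → P ∣ V
irreducible∣rem*⇒∣ {P} P-irr V r₀ r₀<P P∣r₀V with irreducible-nz P-irr
... | p , refl = go r₀ (<-wellFounded (deg⁺ r₀)) r₀<P P∣r₀V
  where
  go : ∀ r → Acc _<_ (deg⁺ r) → deg⁺ r < deg⁺ p → nz p ∣ (nz r * V) → nz p ∣ V
  go r (acc rec) r<p p∣rV with divMod (nz p) r
  ... | s , 0p , eq , _ with proj₂ P-irr (nz r) (s , trans (*-comm (nz r) s) (trans (sym (+-identityʳ _)) (sym eq)))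
  ...   | inj₁ r≡one = subst (λ z → nz p ∣ (z * V)) r≡one p∣rV
  ...   | inj₂ refl  = ⊥-elim (ℕₚ.<-irrefl refl r<p)
  go r (acc rec) r<p p∣rV | s , nz t , eq , t<r =
    go t (rec t<r) (ℕₚ.<-trans t<r r<p)
       (subst (nz p ∣_) (sym tV≡) (∣-+ (nz p) (∣-*ʳ (nz p) V (∣-refl (nz p))) (∣-*ˡ (nz p) s p∣rV)))
    where
    tV≡ : nz t * V ≡ nz p * V + s * (nz r * V)
    tV≡ = begin
      nz t * V                      ≡⟨ cong (_* V) (trans (sym (+-cancelˡ (s * nz r) (nz t))) (cong (s * nz r +_) (sym eq))) ⟩
      (s * nz r + nz p) * V         ≡⟨ cong (_* V) (+-comm (s * nz r) (nz p)) ⟩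
      (nz p + s * nz r) * V         ≡⟨ *-distribʳ-+ (nz p) (s * nz r) V ⟩
      nz p * V + (s * nz r) * V     ≡⟨ cong (nz p * V +_) (*-assoc s (nz r) V) ⟩
      nz p * V + s * (nz r * V)     ∎
      where open ≡-Reasoning

euclid : ∀ {P} → Irreducible P → ∀ U V → P ∣ (U * V) → P ∣ U ⊎ P ∣ V
euclid {P} P-irr U V P∣UV with irreducible-nz P-irr
... | p , refl with divMod U p
... | q , 0p , eq , _ = inj₁ (q , trans (*-comm (nz p) q) (trans (sym (+-identityʳ (q * nz p))) (sym eq)))
... | q , nz r , eq , r<p = inj₂ (irreducible∣rem*⇒∣ P-irr V r r<p
      (subst (nz p ∣_) (sym rV≡) (∣-+ (nz p) (∣-*ʳ (nz p) V (∣-*ˡ (nz p) q (∣-refl (nz p)))) P∣UV)))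
  where
  rV≡ : nz r * V ≡ (q * nz p) * V + U * V
  rV≡ = trans (cong (_* V) (trans (sym (+-cancelˡ (q * nz p) (nz r))) (cong (q * nz p +_) (sym eq))))
              (*-distribʳ-+ (q * nz p) U V)

∤-cancel-irreducible : ∀ {P} → Irreducible P → ∀ F R → ¬ P ∣ F → F ∣ (R * P) → F ∣ R
∤-cancel-irreducible {P} P-irr F R P∤F (Q , FQ≡RP) with euclid P-irr F Q (subst (P ∣_) (sym FQ≡RP) (R , *-comm P R))
... | inj₁ P∣F          = ⊥-elim (P∤F P∣F)
... | inj₂ (Q′ , PQ′≡Q) = Q′ , *-cancelˡ P (F * Q′) R (irreducible≢0 P-irr) (begin
  P * (F * Q′) ≡⟨ *-assoc P F Q′ ⟨
  (P * F) * Q′ ≡⟨ cong (_* Q′) (*-comm P F) ⟩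
  (F * P) * Q′ ≡⟨ *-assoc F P Q′ ⟩
  F * (P * Q′) ≡⟨ cong (F *_) PQ′≡Q ⟩
  F * Q        ≡⟨ FQ≡RP ⟩
  R * P        ≡⟨ *-comm R P ⟩
  P * R        ∎)
  where open ≡-Reasoning

∤-cancel-irreducible^ : ∀ {P} → Irreducible P → ∀ F R c → ¬ P ∣ F → F ∣ (R * P ^ c) → F ∣ R
∤-cancel-irreducible^ P-irr F R zero    P∤F F∣R = subst (F ∣_) (*-identityʳ R) F∣R
∤-cancel-irreducible^ {P} P-irr F R (suc c) P∤F F∣RPᶜ⁺¹ =
  ∤-cancel-irreducible^ P-irr F R c P∤F (∤-cancel-irreducible P-irr F (R * P ^ c) P∤F
    (subst (F ∣_) (trans (cong (R *_) (*-comm P (P ^ c))) (sym (*-assoc R (P ^ c) P))) F∣RPᶜ⁺¹))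

irreducible∣^⇒∣ : ∀ {P} → Irreducible P → ∀ Q n → P ∣ (Q ^ n) → P ∣ Q
irreducible∣^⇒∣ P-irr Q zero    P∣one = ⊥-elim (irreducible∤one P-irr P∣one)
irreducible∣^⇒∣ P-irr Q (suc n) P∣Qⁿ⁺¹ with euclid P-irr Q (Q ^ n) P∣Qⁿ⁺¹
... | inj₁ P∣Q  = P∣Q
... | inj₂ P∣Qⁿ = irreducible∣^⇒∣ P-irr Q n P∣Qⁿ

irreducible∣irreducible⇒≡ : ∀ {P Q} → Irreducible P → Irreducible Q → P ∣ Q → P ≡ Q
irreducible∣irreducible⇒≡ {P} P-irr Q-irr P∣Q with proj₂ Q-irr P P∣Q
... | inj₁ P≡one = ⊥-elim (proj₁ P-irr (cong deg P≡one))
... | inj₂ P≡Q   = P≡Q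

deg1⇒irreducible : ∀ l → deg⁺ l ≡ 1 → Irreducible (nz l)
deg1⇒irreducible l dl = (λ d≡0 → 1≢0 (trans (sym dl) d≡0)) , divisors
  where
  1≢0 : ¬ 1 ≡ 0
  1≢0 ()
  divisors : ∀ D → D ∣ nz l → D ≡ one ⊎ D ≡ nz l
  divisors D (Q , DQ≡l) with *≡nz D Q l DQ≡l
  ... | 1p     , q , refl , _    , _  = inj₁ refl
  ... | b ∷⁺ d , q , refl , refl , de = inj₂ (begin
    nz (b ∷⁺ d)          ≡⟨ *-identityʳ _ ⟨
    nz (b ∷⁺ d) * one    ≡⟨ cong (nz (b ∷⁺ d) *_) (deg⁺≡0⇒≡one q q≡0) ⟨
    nz (b ∷⁺ d) * nz q   ≡⟨ DQ≡l ⟩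
    nz l                 ∎)
    where
    open ≡-Reasoning
    q≡0 : deg⁺ q ≡ 0
    q≡0 = ℕₚ.m+n≡0⇒n≡0 (deg⁺ d) (ℕₚ.suc-injective (trans de dl))

-- Splitting

deg1⇒X⊎X+1 : ∀ D → deg D ≡ 1 → D ≡ X ⊎ D ≡ X+1
deg1⇒X⊎X+1 (nz (false ∷⁺ 1p)) _ = inj₁ refl
deg1⇒X⊎X+1 (nz (true ∷⁺ 1p))  _ = inj₂ refl
deg1⇒X⊎X+1 0p                 ()
deg1⇒X⊎X+1 (nz 1p)            ()
deg1⇒X⊎X+1 (nz (_ ∷⁺ (_ ∷⁺ _))) ()

odd-irreducible∣⇒¬Splits : ∀ {P} → Odd P → Irreducible P → ∀ T → P ∣ T → ¬ Splits T
odd-irreducible∣⇒¬Splits {P} P-odd P-irr T P∣T (L , degs , prodL≡T) = go L degs (subst (P ∣_) (sym prodL≡T) P∣T)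
  where
  P∤X*X+1 : ¬ P ∣ (X * X+1)
  P∤X*X+1 P∣XX+1 = proj₁ P-irr (cong deg (P-odd P (∣-refl P) P∣XX+1))

  P∤deg1 : ∀ D → deg D ≡ 1 → ¬ P ∣ D
  P∤deg1 D dD P∣D with deg1⇒X⊎X+1 D dD
  ... | inj₁ refl = P∤X*X+1 (∣-*ʳ P X+1 P∣D)
  ... | inj₂ refl = P∤X*X+1 (∣-*ˡ P X P∣D)

  go : ∀ L → All (λ D → deg D ≡ 1) L → ¬ P ∣ prod L
  go []      []         P∣one = irreducible∤one P-irr P∣one
  go (D ∷ L) (dD ∷ dL) P∣DL with euclid P-irr D (prod L) P∣DL
  ... | inj₁ P∣D = P∤deg1 D dD P∣D
  ... | inj₂ P∣L = go L dL P∣L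

prod-++ : ∀ xs ys → prod (xs ++ ys) ≡ prod xs * prod ys
prod-++ []       ys = refl
prod-++ (x ∷ xs) ys = trans (cong (x *_) (prod-++ xs ys)) (sym (*-assoc x (prod xs) (prod ys)))

*-splits : ∀ {S T} → Splits S → Splits T → Splits (S * T)
*-splits (L₁ , deg₁ , ∏L₁≡S) (L₂ , deg₂ , ∏L₂≡T) =
  L₁ ++ L₂ , All.++⁺ deg₁ deg₂ , trans (prod-++ L₁ L₂) (cong₂ _*_ ∏L₁≡S ∏L₂≡T)

^-splits : ∀ {D} → deg D ≡ 1 → ∀ n → Splits (D ^ n)
^-splits     dD zero    = [] , [] , refl
^-splits {D} dD (suc n) = *-splits (D ∷ [] , dD ∷ [] , *-identityʳ D) (^-splits dD n)

-- The exhaustive searches defining σ**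

T-== : ∀ p q → T (p == q) ⇔ p ≡ q
T-== p q = mk⇔ (sound p q) (λ { refl → complete p })
  where
  sound⁺ : ∀ p q → T (p ==⁺ q) → p ≡ q
  sound⁺ 1p           1p           _ = refl
  sound⁺ (false ∷⁺ p) (false ∷⁺ q) t = cong (false ∷⁺_) (sound⁺ p q t)
  sound⁺ (true ∷⁺ p)  (true ∷⁺ q)  t = cong (true ∷⁺_) (sound⁺ p q t)
  sound⁺ 1p           (_ ∷⁺ _)     ()
  sound⁺ (_ ∷⁺ _)     1p           ()
  sound⁺ (false ∷⁺ p) (true ∷⁺ q)  ()
  sound⁺ (true ∷⁺ p)  (false ∷⁺ q) ()
  sound : ∀ p q → T (p == q) → p ≡ q
  sound 0p     0p     _ = refl
  sound (nz p) (nz q) t = cong nz (sound⁺ p q t)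
  sound 0p     (nz _) ()
  sound (nz _) 0p     ()
  complete⁺ : ∀ p → T (p ==⁺ p)
  complete⁺ 1p           = _
  complete⁺ (false ∷⁺ p) = complete⁺ p
  complete⁺ (true ∷⁺ p)  = complete⁺ p
  complete : ∀ p → T (p == p)
  complete 0p     = _
  complete (nz p) = complete⁺ p

T-implication : ∀ {a b c} {A B C : Set} → T a ⇔ A → T b ⇔ B → T c ⇔ C → T (not (a ∧ b) ∨ c) ⇔ (A → B → C)
T-implication {false} a⇔A _ _ = mk⇔ (λ _ x → ⊥-elim (Equivalence.from a⇔A x)) _
T-implication {true} {false} _ b⇔B _ = mk⇔ (λ _ _ y → ⊥-elim (Equivalence.from b⇔B y)) _
T-implication {true} {true} a⇔A b⇔B c⇔C = mk⇔
  (λ t _ _ → Equivalence.to c⇔C t)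
  (λ f → Equivalence.from c⇔C (f (Equivalence.to a⇔A _) (Equivalence.to b⇔B _)))

T-not : ∀ b → T (not b) ⇔ (¬ T b)
T-not false = mk⇔ (λ _ ()) _
T-not true  = mk⇔ (λ ()) (λ ¬t → ¬t _)

module _ {A : Set} where

  T-anyL : ∀ (f : A → Bool) xs → T (anyL f xs) ⇔ (∃ λ x → x ∈ xs × T (f x))
  T-anyL f xs = mk⇔ (to xs) (λ (x , x∈xs , t) → from xs x∈xs t)
    where
    to : ∀ xs → T (anyL f xs) → ∃ λ x → x ∈ xs × T (f x)
    to (a ∷ as) t with f a in fa
    ... | true  = a , here refl , subst T (sym fa) _
    ... | false = let (x , x∈as , tx) = to as t in x , there x∈as , tx
    from : ∀ xs {x} → x ∈ xs → T (f x) → T (anyL f xs)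
    from (a ∷ as) (here refl) t with f a
    ... | true = _
    from (a ∷ as) (there x∈as) t with f a
    ... | true  = _
    ... | false = from as x∈as t

  T-allL : ∀ (f : A → Bool) xs → T (allL f xs) ⇔ (∀ x → x ∈ xs → T (f x))
  T-allL f xs = mk⇔ (to xs) (from xs)
    where
    to : ∀ xs → T (allL f xs) → ∀ x → x ∈ xs → T (f x)
    to (a ∷ as) t x (here refl)  = proj₁ (Equivalence.to T-∧ t)
    to (a ∷ as) t x (there x∈as) = to as (proj₂ (Equivalence.to T-∧ t)) x x∈as
    from : ∀ xs → (∀ x → x ∈ xs → T (f x)) → T (allL f xs)
    from []       _ = _
    from (a ∷ as) h = Equivalence.from T-∧ (h a (here refl) , from as (λ x x∈as → h x (there x∈as)))

  T-anyL-search : ∀ (f : A → Bool) (P : A → Set) xs → (∀ x → T (f x) ⇔ P x) → (∀ x → P x → x ∈ xs) →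
                  T (anyL f xs) ⇔ (∃ λ x → P x)
  T-anyL-search f P xs f⇔P complete = mk⇔
    (λ t → let (x , _ , tx) = Equivalence.to (T-anyL f xs) t in x , Equivalence.to (f⇔P x) tx)
    (λ (x , px) → Equivalence.from (T-anyL f xs) (x , complete x px , Equivalence.from (f⇔P x) px))

  T-allL-search : ∀ (f : A → Bool) (P Q : A → Set) xs → (∀ x → T (f x) ⇔ (P x → Q x)) → (∀ x → P x → x ∈ xs) →
                  T (allL f xs) ⇔ (∀ x → P x → Q x)
  T-allL-search f P Q xs f⇔P→Q complete = mk⇔
    (λ t x px → Equivalence.to (f⇔P→Q x) (Equivalence.to (T-allL f xs) t x (complete x px)) px)
    (λ h → Equivalence.from (T-allL f xs) (λ x _ → Equivalence.from (f⇔P→Q x) (h x)))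

polys<-suc : ∀ n → polys< (suc n) ≡ cartesianProductWith (λ p b → cons b p) (polys< n) (false ∷ true ∷ [])
polys<-suc n = go (polys< n)
  where
  go : ∀ ps → concatL (mapL (λ p → cons false p ∷ cons true p ∷ []) ps)
            ≡ cartesianProductWith (λ p b → cons b p) ps (false ∷ true ∷ [])
  go []       = refl
  go (p ∷ ps) = cong (λ r → cons false p ∷ cons true p ∷ r) (go ps)

polys<-unique : ∀ n → Unique (polys< n)
polys<-unique zero    = [] ∷ []
polys<-unique (suc n) rewrite polys<-suc n =
  Unique.cartesianProductWith⁺ (λ p b → cons b p) cons-injective (polys<-unique n) (((λ ()) ∷ []) ∷ [] ∷ [])

∈-polys< : ∀ n p → len p ≤ n → p ∈ polys< n
∈-polys< zero    0p     _ = here refl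
∈-polys< (suc n) p      p≤ rewrite polys<-suc n =
  subst (_∈ _) (cons-coeff₀-quotX p)
    (∈-cartesianProductWith⁺ (λ p b → cons b p) (∈-polys< n (quotX p) (len-quotX p p≤)) (∈-bools (coeff₀ p)))
  where
  len-quotX : ∀ p → len p ≤ suc n → len (quotX p) ≤ n
  len-quotX 0p              _         = z≤n
  len-quotX (nz 1p)         _         = z≤n
  len-quotX (nz (_ ∷⁺ p))   (s≤s p≤n) = p≤n
  ∈-bools : ∀ b → b ∈ false ∷ true ∷ []
  ∈-bools false = here refl
  ∈-bools true  = there (here refl)

∣⇒∈polys≤ : ∀ D s → D ∣ nz s → D ∈ polys≤ (deg⁺ s)
∣⇒∈polys≤ D s D∣s with ∣-nz D D∣s
... | d , refl , d≤s = ∈-polys< (suc (deg⁺ s)) (nz d) (s≤s d≤s)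

UnitaryDivisor : F2[x] → F2[x] → Set
UnitaryDivisor E D = Σ F2[x] λ R → E * R ≡ D × Coprime E R

UnitarilyCoprime : F2[x] → F2[x] → Set
UnitarilyCoprime D Q = ∀ E → UnitaryDivisor E D → UnitaryDivisor E Q → E ≡ one

BiUnitaryDivisor : F2[x] → F2[x] → Set
BiUnitaryDivisor D S = Σ F2[x] λ Q → D * Q ≡ S × UnitarilyCoprime D Q

cofactor∈polys≤ : ∀ D Q s → D * Q ≡ nz s → Q ∈ polys≤ (deg⁺ s)
cofactor∈polys≤ D Q s e = ∣⇒∈polys≤ Q s (D , trans (*-comm Q D) e)

-- c? need only be correct on nonzero arguments, which D * Q ≡ nz s guarantees.
T-product≡nz-∧ : (c? : F2[x] → F2[x] → Bool) (C : F2[x] → F2[x] → Set) →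
                (∀ a b → T (c? (nz a) (nz b)) ⇔ C (nz a) (nz b)) →
                ∀ D Q s → T ((D * Q == nz s) ∧ c? D Q) ⇔ (D * Q ≡ nz s × C D Q)
T-product≡nz-∧ c? C c?⇔C D Q s = mk⇔ to from
  where
  to : T ((D * Q == nz s) ∧ c? D Q) → D * Q ≡ nz s × C D Q
  to t with Equivalence.to T-∧ t
  ... | t₁ , t₂ with Equivalence.to (T-== (D * Q) (nz s)) t₁
  ... | e with *≡nz D Q s e
  ... | d , q , refl , refl , _ = e , Equivalence.to (c?⇔C d q) t₂
  from : D * Q ≡ nz s × C D Q → T ((D * Q == nz s) ∧ c? D Q)
  from (e , c) with *≡nz D Q s e
  ... | d , q , refl , refl , _ = Equivalence.from T-∧ (Equivalence.from (T-== _ _) e , Equivalence.from (c?⇔C d q) c)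

divides?-correct : ∀ D s → T (divides? D (nz s)) ⇔ D ∣ nz s
divides?-correct D s = T-anyL-search _ (λ Q → D * Q ≡ nz s) (polys≤ (deg⁺ s))
  (λ Q → T-== (D * Q) (nz s)) (λ Q e → cofactor∈polys≤ D Q s e)

coprime?-correct : ∀ a b → T (coprime? (nz a) (nz b)) ⇔ Coprime (nz a) (nz b)
coprime?-correct a b = T-allL-search _ (_∣ nz a) (λ F → F ∣ nz b → F ≡ one) (polys≤ (deg⁺ a))
  (λ F → T-implication (divides?-correct F a) (divides?-correct F b) (T-== F one)) (λ F F∣a → ∣⇒∈polys≤ F a F∣a)

unitary?-correct : ∀ E d → T (unitary? E (nz d)) ⇔ UnitaryDivisor E (nz d)
unitary?-correct E d = T-anyL-search _ (λ R → E * R ≡ nz d × Coprime E R) (polys≤ (deg⁺ d))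
  (λ R → T-product≡nz-∧ coprime? Coprime coprime?-correct E R d) (λ R (e , _) → cofactor∈polys≤ E R d e)

gcdu1?-correct : ∀ d q → T (gcdu1? (nz d) (nz q)) ⇔ UnitarilyCoprime (nz d) (nz q)
gcdu1?-correct d q =
  T-allL-search _ (λ E → UnitaryDivisor E (nz d)) (λ E → UnitaryDivisor E (nz q) → E ≡ one) (polys≤ (deg⁺ d))
  (λ E → T-implication (unitary?-correct E d) (unitary?-correct E q) (T-== E one)) (λ E (R , e , _) → ∣⇒∈polys≤ E d (R , e))

biunitary?-correct : ∀ D s → T (biunitary? D (nz s)) ⇔ BiUnitaryDivisor D (nz s)
biunitary?-correct D s = T-anyL-search _ (λ Q → D * Q ≡ nz s × UnitarilyCoprime D Q) (polys≤ (deg⁺ s))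
  (λ Q → T-product≡nz-∧ gcdu1? UnitarilyCoprime gcdu1?-correct D Q s) (λ Q (e , _) → cofactor∈polys≤ D Q s e)

divides?-sound : ∀ D S → T (divides? D S) → D ∣ S
divides?-sound D 0p     _ = ∣-0 D
divides?-sound D (nz s) t = Equivalence.to (divides?-correct D s) t

module _ {A : Set} where

  filterL≡filter : ∀ (f : A → Bool) xs → filterL f xs ≡ filter (T? ∘ f) xs
  filterL≡filter f []       = refl
  filterL≡filter f (a ∷ as) with f a
  ... | true  = cong (a ∷_) (filterL≡filter f as)
  ... | false = filterL≡filter f as

  ∈-filterL : ∀ (f : A → Bool) xs {x} → x ∈ filterL f xs ⇔ (x ∈ xs × T (f x))
  ∈-filterL f xs rewrite filterL≡filter f xs = mk⇔ (∈-filter⁻ (T? ∘ f)) (λ (x∈xs , t) → ∈-filter⁺ (T? ∘ f) x∈xs t)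

  filterL-unique : ∀ (f : A → Bool) {xs} → Unique xs → Unique (filterL f xs)
  filterL-unique f {xs} u rewrite filterL≡filter f xs = Unique.filter⁺ (T? ∘ f) u

sumP-++ : ∀ xs ys → sumP (xs ++ ys) ≡ sumP xs + sumP ys
sumP-++ []       ys = refl
sumP-++ (x ∷ xs) ys = trans (cong (x +_) (sumP-++ xs ys)) (sym (+-assoc x (sumP xs) (sumP ys)))

sumP-↭ : ∀ {xs ys} → xs ↭ ys → sumP xs ≡ sumP ys
sumP-↭ ↭.refl                = refl
sumP-↭ (↭.prep x xs↭ys)      = cong (x +_) (sumP-↭ xs↭ys)
sumP-↭ (↭.swap x y xs↭ys)    = trans (+-left-comm x y _) (cong (λ s → y + (x + s)) (sumP-↭ xs↭ys))
sumP-↭ (↭.trans xs↭ys ys↭zs) = trans (sumP-↭ xs↭ys) (sumP-↭ ys↭zs)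

sumP-set : ∀ {xs ys} → Unique xs → Unique ys → xs ∼[ set ] ys → sumP xs ≡ sumP ys
sumP-set uxs uys xs∼ys = sumP-↭ (∼bag⇒↭ (unique∧set⇒bag uxs uys xs∼ys))

sumP-partition : ∀ (f : F2[x] → Bool) xs → sumP xs ≡ sumP (filterL f xs) + sumP (filterL (not ∘ f) xs)
sumP-partition f []       = refl
sumP-partition f (a ∷ as) with f a
... | true  = trans (cong (a +_) (sumP-partition f as)) (sym (+-assoc a (sumP (filterL f as)) _))
... | false = trans (cong (a +_) (sumP-partition f as)) (+-left-comm a (sumP (filterL f as)) _)

∣-sumP : ∀ D xs → (∀ x → x ∈ xs → D ∣ x) → D ∣ sumP xs
∣-sumP D []       _ = ∣-0 D
∣-sumP D (a ∷ as) h = ∣-+ D (h a (here refl)) (∣-sumP D as (λ x x∈as → h x (there x∈as)))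

biunitaryDivisors : F2[x] → List F2[x]
biunitaryDivisors S = filterL (λ D → not (D == 0p) ∧ biunitary? D S) (polys≤ (deg S))

∈-biunitaryDivisors : ∀ s {D} → D ∈ biunitaryDivisors (nz s) ⇔ BiUnitaryDivisor D (nz s)
∈-biunitaryDivisors s {D} = mk⇔
  (λ D∈ → Equivalence.to (biunitary?-correct D s)
            (proj₂ (Equivalence.to T-∧ (proj₂ (Equivalence.to (∈-filterL _ (polys≤ (deg⁺ s))) D∈)))))
  from
  where
  from : BiUnitaryDivisor D (nz s) → D ∈ biunitaryDivisors (nz s)
  from bu@(Q , e , _) with *≡nz D Q s e
  ... | d , _ , refl , _ = Equivalence.from (∈-filterL _ (polys≤ (deg⁺ s)))
    (∣⇒∈polys≤ D s (Q , e) , Equivalence.from T-∧ (_ , Equivalence.from (biunitary?-correct D s) bu))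

biunitaryDivisors-unique : ∀ S → Unique (biunitaryDivisors S)
biunitaryDivisors-unique S = filterL-unique _ (polys<-unique (suc (deg S)))

σ**≡sumP : ∀ s L → Unique L → (∀ {D} → D ∈ L ⇔ BiUnitaryDivisor D (nz s)) → σ** (nz s) ≡ sumP L
σ**≡sumP s L uL L⇔ = sumP-set (biunitaryDivisors-unique (nz s)) uL
  (λ {D} → mk⇔ (λ D∈ → Equivalence.from L⇔ (Equivalence.to (∈-biunitaryDivisors s) D∈))
               (λ D∈ → Equivalence.from (∈-biunitaryDivisors s) (Equivalence.to L⇔ D∈)))

-- σ** modulo an irreducible factor

∤⇒≢0 : ∀ P {E} → ¬ P ∣ E → ¬ E ≡ 0p
∤⇒≢0 P P∤E refl = P∤E (∣-0 P)

module _ {P} (P-irr : Irreducible P) (c : ℕ) where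

  ∤-cofactor-*^ : ∀ E W R → ¬ P ∣ E → E * R ≡ W * P ^ c → Σ F2[x] λ R′ → E * R′ ≡ W × R ≡ R′ * P ^ c
  ∤-cofactor-*^ E W R P∤E ER≡WPᶜ with ∤-cancel-irreducible^ P-irr E W c P∤E (R , ER≡WPᶜ)
  ... | R′ , ER′≡W = R′ , ER′≡W , *-cancelˡ E R (R′ * P ^ c) (∤⇒≢0 P P∤E)
                                    (trans ER≡WPᶜ (trans (cong (_* P ^ c) (sym ER′≡W)) (*-assoc E R′ (P ^ c))))

  unitaryDivisor-*^ : ∀ E W → ¬ P ∣ E → UnitaryDivisor E W → UnitaryDivisor E (W * P ^ c)
  unitaryDivisor-*^ E W P∤E (R , ER≡W , E⊥R) =
    R * P ^ c , trans (sym (*-assoc E R (P ^ c))) (cong (_* P ^ c) ER≡W) ,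
    λ F F∣E F∣RPᶜ → E⊥R F F∣E (∤-cancel-irreducible^ P-irr F R c (λ P∣F → P∤E (∣-trans P P∣F F∣E)) F∣RPᶜ)

  unitaryDivisor-/^ : ∀ E W → ¬ P ∣ E → UnitaryDivisor E (W * P ^ c) → UnitaryDivisor E W
  unitaryDivisor-/^ E W P∤E (R , ER≡WPᶜ , E⊥R) with ∤-cofactor-*^ E W R P∤E ER≡WPᶜ
  ... | R′ , ER′≡W , R≡R′Pᶜ =
    R′ , ER′≡W , λ F F∣E F∣R′ → E⊥R F F∣E (subst (F ∣_) (sym R≡R′Pᶜ) (∣-*ʳ F (P ^ c) F∣R′))

  unitarilyCoprime-*^ : ∀ D W → ¬ P ∣ D → UnitarilyCoprime D W → UnitarilyCoprime D (W * P ^ c)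
  unitarilyCoprime-*^ D W P∤D D⊥W E E∣D@(R , ER≡D , _) E∣WPᶜ =
    D⊥W E E∣D (unitaryDivisor-/^ E W (λ P∣E → P∤D (∣-trans P P∣E (R , ER≡D))) E∣WPᶜ)

  unitarilyCoprime-/^ : ∀ D W → ¬ P ∣ D → UnitarilyCoprime D (W * P ^ c) → UnitarilyCoprime D W
  unitarilyCoprime-/^ D W P∤D D⊥WPᶜ E E∣D@(R , ER≡D , _) E∣W =
    D⊥WPᶜ E E∣D (unitaryDivisor-*^ E W (λ P∣E → P∤D (∣-trans P P∣E (R , ER≡D))) E∣W)

  biUnitaryDivisor-*^⇔ : ∀ D B → ¬ P ∣ D → BiUnitaryDivisor D (B * P ^ c) ⇔ BiUnitaryDivisor D B
  biUnitaryDivisor-*^⇔ D B P∤D = mk⇔ to from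
    where
    to : BiUnitaryDivisor D (B * P ^ c) → BiUnitaryDivisor D B
    to (Q , DQ≡BPᶜ , D⊥Q) with ∤-cofactor-*^ D B Q P∤D DQ≡BPᶜ
    ... | Q′ , DQ′≡B , refl = Q′ , DQ′≡B , unitarilyCoprime-/^ D Q′ P∤D D⊥Q
    from : BiUnitaryDivisor D B → BiUnitaryDivisor D (B * P ^ c)
    from (Q , DQ≡B , D⊥Q) = Q * P ^ c , trans (sym (*-assoc D Q (P ^ c))) (cong (_* P ^ c) DQ≡B) ,
                             unitarilyCoprime-*^ D Q P∤D D⊥Q

biunitaryDivisorsPrimeTo : F2[x] → F2[x] → List F2[x]
biunitaryDivisorsPrimeTo P S = filterL (not ∘ divides? P) (biunitaryDivisors S)

∈-biunitaryDivisorsPrimeTo : ∀ P s {D} → D ∈ biunitaryDivisorsPrimeTo P (nz s) ⇔ (BiUnitaryDivisor D (nz s) × ¬ P ∣ D)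
∈-biunitaryDivisorsPrimeTo P s {D} = mk⇔ to from
  where
  T-not-divides? : BiUnitaryDivisor D (nz s) → T (not (divides? P D)) ⇔ (¬ P ∣ D)
  T-not-divides? (Q , DQ≡s , _) with *≡nz D Q s DQ≡s
  ... | d , _ , refl , _ = mk⇔
    (λ t P∣D → Equivalence.to (T-not (divides? P D)) t (Equivalence.from (divides?-correct P d) P∣D))
    (λ P∤D → Equivalence.from (T-not (divides? P D)) (λ t → P∤D (Equivalence.to (divides?-correct P d) t)))
  to : D ∈ biunitaryDivisorsPrimeTo P (nz s) → BiUnitaryDivisor D (nz s) × ¬ P ∣ D
  to D∈ with Equivalence.to (∈-filterL (not ∘ divides? P) (biunitaryDivisors (nz s))) D∈
  ... | D∈′ , t = let bu = Equivalence.to (∈-biunitaryDivisors s) D∈′ in bu , Equivalence.to (T-not-divides? bu) t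
  from : BiUnitaryDivisor D (nz s) × ¬ P ∣ D → D ∈ biunitaryDivisorsPrimeTo P (nz s)
  from (bu , P∤D) = Equivalence.from (∈-filterL (not ∘ divides? P) (biunitaryDivisors (nz s)))
    (Equivalence.from (∈-biunitaryDivisors s) bu , Equivalence.from (T-not-divides? bu) P∤D)

sumP-biunitaryDivisorsPrimeTo-*^ : ∀ {P} → Irreducible P → ∀ c β α → nz β * P ^ c ≡ nz α →
  sumP (biunitaryDivisorsPrimeTo P (nz α)) ≡ sumP (biunitaryDivisorsPrimeTo P (nz β))
sumP-biunitaryDivisorsPrimeTo-*^ {P} P-irr c β α βPᶜ≡α = sumP-set
  (filterL-unique (not ∘ divides? P) (biunitaryDivisors-unique (nz α)))
  (filterL-unique (not ∘ divides? P) (biunitaryDivisors-unique (nz β)))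
  (λ {D} → mk⇔ (λ D∈ → let (bu , P∤D) = Equivalence.to (∈-biunitaryDivisorsPrimeTo P α) D∈ in
                       Equivalence.from (∈-biunitaryDivisorsPrimeTo P β) (Equivalence.to (transfer D P∤D) bu , P∤D))
               (λ D∈ → let (bu , P∤D) = Equivalence.to (∈-biunitaryDivisorsPrimeTo P β) D∈ in
                       Equivalence.from (∈-biunitaryDivisorsPrimeTo P α) (Equivalence.from (transfer D P∤D) bu , P∤D)))
  where
  transfer : ∀ D → ¬ P ∣ D → BiUnitaryDivisor D (nz α) ⇔ BiUnitaryDivisor D (nz β)
  transfer D P∤D rewrite sym βPᶜ≡α = biUnitaryDivisor-*^⇔ P-irr c D (nz β) P∤D

σ**-*^-≡-mod : ∀ {P} → Irreducible P → ∀ B c → ¬ B ≡ 0p → P ∣ (σ** (B * P ^ c) + σ** B)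
σ**-*^-≡-mod {P} P-irr B c B≢0 with ≢0⇒nz B B≢0 | ≢0⇒nz (B * P ^ c) (*-≢0 B≢0 (^-≢0 (irreducible≢0 P-irr) c))
... | β , refl | α , βPᶜ≡α rewrite βPᶜ≡α = subst (P ∣_) (sym σ**α+σ**β≡) (∣-+ P (P∣divisible α) (P∣divisible β))
  where
  divisible primeTo : Poly⁺ → F2[x]
  divisible s = sumP (filterL (divides? P) (biunitaryDivisors (nz s)))
  primeTo   s = sumP (biunitaryDivisorsPrimeTo P (nz s))

  P∣divisible : ∀ s → P ∣ divisible s
  P∣divisible s = ∣-sumP P _ λ D D∈ →
    divides?-sound P D (proj₂ (Equivalence.to (∈-filterL (divides? P) (biunitaryDivisors (nz s))) D∈))

  σ**α+σ**β≡ : σ** (nz α) + σ** (nz β) ≡ divisible α + divisible β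
  σ**α+σ**β≡ = begin
    σ** (nz α) + σ** (nz β)
      ≡⟨ cong₂ _+_ (sumP-partition (divides? P) (biunitaryDivisors (nz α)))
                   (sumP-partition (divides? P) (biunitaryDivisors (nz β))) ⟩
    (divisible α + primeTo α) + (divisible β + primeTo β)
      ≡⟨ +-interchange (divisible α) (primeTo α) (divisible β) (primeTo β) ⟩
    (divisible α + divisible β) + (primeTo α + primeTo β)
      ≡⟨ cong (λ z → (divisible α + divisible β) + (z + primeTo β)) (sumP-biunitaryDivisorsPrimeTo-*^ P-irr c β α βPᶜ≡α) ⟩
    (divisible α + divisible β) + (primeTo β + primeTo β)
      ≡⟨ cong (divisible α + divisible β +_) (+-self (primeTo β)) ⟩
    (divisible α + divisible β) + 0p
      ≡⟨ +-identityʳ (divisible α + divisible β) ⟩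
    divisible α + divisible β
      ∎
    where open ≡-Reasoning

geomSum : F2[x] → ℕ → F2[x]
geomSum y n = sumP (map (y ^_) (downFrom (suc n)))

module _ {A : Set} where

  sumP-map-*ˡ : ∀ c (h : A → F2[x]) xs → sumP (map (λ x → c * h x) xs) ≡ c * sumP (map h xs)
  sumP-map-*ˡ c h []       = sym (*-zeroʳ c)
  sumP-map-*ˡ c h (x ∷ xs) = trans (cong (c * h x +_) (sumP-map-*ˡ c h xs)) (sym (*-distribˡ-+ c (h x) _))

  sumP-cartesianProductWith-* : ∀ (f g : A → F2[x]) xs ys →
    sumP (cartesianProductWith (λ x y → f x * g y) xs ys) ≡ sumP (map f xs) * sumP (map g ys)
  sumP-cartesianProductWith-* f g []       ys = refl
  sumP-cartesianProductWith-* f g (x ∷ xs) ys = begin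
    sumP (map (λ y → f x * g y) ys ++ cartesianProductWith (λ x y → f x * g y) xs ys)
      ≡⟨ sumP-++ (map (λ y → f x * g y) ys) _ ⟩
    sumP (map (λ y → f x * g y) ys) + sumP (cartesianProductWith (λ x y → f x * g y) xs ys)
      ≡⟨ cong₂ _+_ (sumP-map-*ˡ (f x) g ys) (sumP-cartesianProductWith-* f g xs ys) ⟩
    f x * sumP (map g ys) + sumP (map f xs) * sumP (map g ys)
      ≡⟨ *-distribʳ-+ (f x) (sumP (map f xs)) (sumP (map g ys)) ⟨
    (f x + sumP (map f xs)) * sumP (map g ys)
      ∎
    where open ≡-Reasoning

-- Divisors of P ^ a * Q ^ b for distinct irreducibles P, Q

irreducible-peel : ∀ {F} → Irreducible F → ∀ D R M → D * R ≡ F * M →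
                   (Σ F2[x] λ D′ → D ≡ F * D′ × D′ * R ≡ M) ⊎ (Σ F2[x] λ R′ → R ≡ F * R′ × D * R′ ≡ M)
irreducible-peel {F} F-irr D R M DR≡FM with euclid F-irr D R (M , sym DR≡FM)
... | inj₁ (D′ , FD′≡D) = inj₁ (D′ , sym FD′≡D , *-cancelˡ F (D′ * R) M (irreducible≢0 F-irr) (begin
  F * (D′ * R) ≡⟨ *-assoc F D′ R ⟨
  (F * D′) * R ≡⟨ cong (_* R) FD′≡D ⟩
  D * R        ≡⟨ DR≡FM ⟩
  F * M        ∎))
  where open ≡-Reasoning
... | inj₂ (R′ , FR′≡R) = inj₂ (R′ , sym FR′≡R , *-cancelˡ F (D * R′) M (irreducible≢0 F-irr) (begin
  F * (D * R′) ≡⟨ *-assoc F D R′ ⟨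
  (F * D) * R′ ≡⟨ cong (_* R′) (*-comm F D) ⟩
  (D * F) * R′ ≡⟨ *-assoc D F R′ ⟩
  D * (F * R′) ≡⟨ cong (D *_) FR′≡R ⟩
  D * R        ≡⟨ DR≡FM ⟩
  F * M        ∎))
  where open ≡-Reasoning

^*-injective : ∀ {F} → Irreducible F → ∀ {U V} k k′ → ¬ F ∣ U → ¬ F ∣ V →
               F ^ k * U ≡ F ^ k′ * V → k ≡ k′ × U ≡ V
^*-injective F-irr zero    zero     _   _   U≡V = refl , U≡V
^*-injective {F} F-irr {U} {V} (suc k) zero F∤U F∤V e =
  ⊥-elim (F∤V (subst (F ∣_) e (subst (F ∣_) (sym (*-assoc F (F ^ k) U)) (F ^ k * U , refl))))
^*-injective {F} F-irr {U} {V} zero (suc k′) F∤U F∤V e =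
  ⊥-elim (F∤U (subst (F ∣_) (sym e) (subst (F ∣_) (sym (*-assoc F (F ^ k′) V)) (F ^ k′ * V , refl))))
^*-injective {F} F-irr {U} {V} (suc k) (suc k′) F∤U F∤V e with
  ^*-injective F-irr k k′ F∤U F∤V (*-cancelˡ F _ _ (irreducible≢0 F-irr)
    (trans (sym (*-assoc F (F ^ k) U)) (trans e (*-assoc F (F ^ k′) V))))
... | k≡k′ , U≡V = cong suc k≡k′ , U≡V

-- a is odd
NotDouble : ℕ → Set
NotDouble a = ∀ k → ¬ k ℕ.+ k ≡ a

module Monomials {P Q : F2[x]} (P-irr : Irreducible P) (Q-irr : Irreducible Q) (P≢Q : ¬ P ≡ Q) where

  mono : ℕ → ℕ → F2[x]
  mono k l = P ^ k * Q ^ l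

  mono-* : ∀ k l k′ l′ → mono k l * mono k′ l′ ≡ mono (k ℕ.+ k′) (l ℕ.+ l′)
  mono-* k l k′ l′ = trans (*-interchange (P ^ k) (Q ^ l) (P ^ k′) (Q ^ l′))
                           (sym (cong₂ _*_ (^-distribˡ-+-* P k k′) (^-distribˡ-+-* Q l l′)))

  mono-≢0 : ∀ k l → ¬ mono k l ≡ 0p
  mono-≢0 k l = *-≢0 (^-≢0 (irreducible≢0 P-irr) k) (^-≢0 (irreducible≢0 Q-irr) l)

  P∣mono : ∀ k l → P ∣ mono (suc k) l
  P∣mono k l = ∣-*ʳ P (Q ^ l) (P ^ k , refl)

  Q∣mono : ∀ k l → Q ∣ mono k (suc l)
  Q∣mono k l = ∣-*ˡ Q (P ^ k) (Q ^ l , refl)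

  P∤Q^ : ∀ l → ¬ P ∣ (Q ^ l)
  P∤Q^ l P∣Qˡ = P≢Q (irreducible∣irreducible⇒≡ P-irr Q-irr (irreducible∣^⇒∣ P-irr Q l P∣Qˡ))

  mono-injective : ∀ k l k′ l′ → mono k l ≡ mono k′ l′ → k ≡ k′ × l ≡ l′
  mono-injective k l k′ l′ e with ^*-injective P-irr k k′ (P∤Q^ l) (P∤Q^ l′) e
  ... | k≡k′ , Qˡ≡Qˡ′ = k≡k′ , proj₁ (^*-injective Q-irr l l′ (irreducible∤one Q-irr) (irreducible∤one Q-irr)
                                         (trans (*-identityʳ (Q ^ l)) (trans Qˡ≡Qˡ′ (sym (*-identityʳ (Q ^ l′))))))

  divisor-of-mono : ∀ a b D R → D * R ≡ mono a b → Σ ℕ λ k → Σ ℕ λ l → k ≤ a × l ≤ b × D ≡ mono k l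
  divisor-of-mono (suc a) b D R DR≡ with irreducible-peel P-irr D R (mono a b) (trans DR≡ (*-assoc P (P ^ a) (Q ^ b)))
  ... | inj₁ (D′ , D≡PD′ , D′R≡) = let (k , l , k≤a , l≤b , D′≡) = divisor-of-mono a b D′ R D′R≡ in
    suc k , l , s≤s k≤a , l≤b , trans D≡PD′ (trans (cong (P *_) D′≡) (sym (*-assoc P (P ^ k) (Q ^ l))))
  ... | inj₂ (R′ , _ , DR′≡) = let (k , l , k≤a , l≤b , D≡) = divisor-of-mono a b D R′ DR′≡ in
    k , l , ℕₚ.m≤n⇒m≤1+n k≤a , l≤b , D≡
  divisor-of-mono zero (suc b) D R DR≡ with irreducible-peel Q-irr D R (mono 0 b) DR≡
  ... | inj₁ (D′ , D≡QD′ , D′R≡) with divisor-of-mono 0 b D′ R D′R≡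
  ...   | .0 , l , z≤n , l≤b , D′≡ = 0 , suc l , z≤n , s≤s l≤b , trans D≡QD′ (cong (Q *_) D′≡)
  divisor-of-mono zero (suc b) D R DR≡ | inj₂ (R′ , _ , DR′≡) =
    let (k , l , k≤0 , l≤b , D≡) = divisor-of-mono 0 b D R′ DR′≡ in k , l , k≤0 , ℕₚ.m≤n⇒m≤1+n l≤b , D≡
  divisor-of-mono zero zero D R DR≡one with *≡nz D R 1p DR≡one
  ... | d , _ , refl , _ , de = 0 , 0 , z≤n , z≤n , deg⁺≡0⇒≡one d (ℕₚ.m+n≡0⇒m≡0 (deg⁺ d) de)

  coprime-mono-P : ∀ k l r s → Coprime (mono k l) (mono r s) → k ≡ 0 ⊎ r ≡ 0
  coprime-mono-P zero    l r       s _   = inj₁ refl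
  coprime-mono-P (suc k) l zero    s _   = inj₂ refl
  coprime-mono-P (suc k) l (suc r) s cop = ⊥-elim (proj₁ P-irr (cong deg (cop P (P∣mono k l) (P∣mono r s))))

  coprime-mono-Q : ∀ k l r s → Coprime (mono k l) (mono r s) → l ≡ 0 ⊎ s ≡ 0
  coprime-mono-Q k zero    r s       _   = inj₁ refl
  coprime-mono-Q k (suc l) r zero    _   = inj₂ refl
  coprime-mono-Q k (suc l) r (suc s) cop = ⊥-elim (proj₁ Q-irr (cong deg (cop Q (Q∣mono k l) (Q∣mono r s))))

  unitary-mono-exponents : ∀ i j k l → UnitaryDivisor (mono k l) (mono i j) → (k ≡ 0 ⊎ k ≡ i) × (l ≡ 0 ⊎ l ≡ j)
  unitary-mono-exponents i j k l (R , ER≡ , E⊥R) with divisor-of-mono i j R (mono k l) (trans (*-comm R (mono k l)) ER≡)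
  ... | r , s , _ , _ , refl with mono-injective (k ℕ.+ r) (l ℕ.+ s) i j (trans (sym (mono-* k l r s)) ER≡)
  ... | k+r≡i , l+s≡j = none-or-all (coprime-mono-P k l r s E⊥R) k+r≡i , none-or-all (coprime-mono-Q k l r s E⊥R) l+s≡j
    where
    none-or-all : ∀ {k r i} → k ≡ 0 ⊎ r ≡ 0 → k ℕ.+ r ≡ i → k ≡ 0 ⊎ k ≡ i
    none-or-all     (inj₁ k≡0)  _     = inj₁ k≡0
    none-or-all {k} (inj₂ refl) k+0≡i = inj₂ (trans (sym (ℕₚ.+-identityʳ k)) k+0≡i)

  -- For odd a, b a common unitary divisor of D and R = P^a Q^b / D would contain P (or Q)
  -- to the full power in both, splitting the odd exponent into two equal halves.
  mono-divisors-biunitary : ∀ {a b} → NotDouble a → NotDouble b → ∀ D R → D * R ≡ mono a b → UnitarilyCoprime D R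
  mono-divisors-biunitary {a} {b} a-odd b-odd D R DR≡ E (R₁ , ER₁≡D , E⊥R₁) E∣ᵤR
    with divisor-of-mono a b D R DR≡ | divisor-of-mono a b R D (trans (*-comm R D) DR≡)
  ... | i , j , _ , _ , refl | i′ , j′ , _ , _ , refl
    with mono-injective (i ℕ.+ i′) (j ℕ.+ j′) a b (trans (sym (mono-* i j i′ j′)) DR≡)
       | divisor-of-mono a b E (R₁ * mono i′ j′) (trans (sym (*-assoc E R₁ _)) (trans (cong (_* mono i′ j′) ER₁≡D) DR≡))
  ... | i+i′≡a , j+j′≡b | k , l , _ , _ , refl
    with unitary-mono-exponents i j k l (R₁ , ER₁≡D , E⊥R₁) | unitary-mono-exponents i′ j′ k l E∣ᵤR
  ... | kᵢ , lⱼ | kᵢ′ , lⱼ′ = cong₂ mono (none a-odd kᵢ kᵢ′ i+i′≡a) (none b-odd lⱼ lⱼ′ j+j′≡b)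
    where
    none : ∀ {k i i′ a} → NotDouble a → k ≡ 0 ⊎ k ≡ i → k ≡ 0 ⊎ k ≡ i′ → i ℕ.+ i′ ≡ a → k ≡ 0
    none         _     (inj₁ k≡0)  _           _     = k≡0
    none         _     (inj₂ _)    (inj₁ k≡0)  _     = k≡0
    none {k = k} a-odd (inj₂ refl) (inj₂ refl) k+k≡a = ⊥-elim (a-odd k k+k≡a)

  σ**-mono : ∀ {a b} → NotDouble a → NotDouble b → σ** (mono a b) ≡ geomSum P a * geomSum Q b
  σ**-mono {a} {b} a-odd b-odd with ≢0⇒nz (mono a b) (mono-≢0 a b)
  ... | μ , μ≡ = begin
    σ** (mono a b) ≡⟨ cong σ** μ≡ ⟩
    σ** (nz μ)     ≡⟨ σ**≡sumP μ divisors divisors-unique (mk⇔ to from) ⟩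
    sumP divisors  ≡⟨ sumP-cartesianProductWith-* (P ^_) (Q ^_) (downFrom (suc a)) (downFrom (suc b)) ⟩
    geomSum P a * geomSum Q b ∎
    where
    open ≡-Reasoning
    divisors : List F2[x]
    divisors = cartesianProductWith mono (downFrom (suc a)) (downFrom (suc b))
    divisors-unique : Unique divisors
    divisors-unique = Unique.cartesianProductWith⁺ mono (mono-injective _ _ _ _)
                                                  (Unique.downFrom⁺ (suc a)) (Unique.downFrom⁺ (suc b))
    to : ∀ {D} → D ∈ divisors → BiUnitaryDivisor D (nz μ)
    to D∈ with ∈-cartesianProductWith⁻ mono (downFrom (suc a)) (downFrom (suc b)) D∈
    ... | i , j , i∈ , j∈ , refl = mono (a ∸ i) (b ∸ j) , trans ij*cofactor≡ μ≡ ,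
                                   mono-divisors-biunitary a-odd b-odd (mono i j) _ ij*cofactor≡
      where
      ij*cofactor≡ : mono i j * mono (a ∸ i) (b ∸ j) ≡ mono a b
      ij*cofactor≡ = trans (mono-* i j (a ∸ i) (b ∸ j))
        (cong₂ mono (ℕₚ.m+[n∸m]≡n (ℕₚ.≤-pred (∈-downFrom⁻ i∈))) (ℕₚ.m+[n∸m]≡n (ℕₚ.≤-pred (∈-downFrom⁻ j∈))))
    from : ∀ {D} → BiUnitaryDivisor D (nz μ) → D ∈ divisors
    from {D} (R , DR≡μ , _) with divisor-of-mono a b D R (trans DR≡μ (sym μ≡))
    ... | k , l , k≤a , l≤b , refl = ∈-cartesianProductWith⁺ mono (∈-downFrom⁺ (s≤s k≤a)) (∈-downFrom⁺ (s≤s l≤b))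

-- Mersenne exponents

geomSum-telescopes : ∀ y n → (one + y) * geomSum y n ≡ one + y ^ suc n
geomSum-telescopes y zero    = trans (*-identityʳ (one + y)) (cong (one +_) (sym (*-identityʳ y)))
geomSum-telescopes y (suc n) = begin
  (one + y) * (Y + geomSum y n)              ≡⟨ *-distribˡ-+ (one + y) Y (geomSum y n) ⟩
  (one + y) * Y + (one + y) * geomSum y n    ≡⟨ cong₂ _+_ (*-distribʳ-+ one y Y) (geomSum-telescopes y n) ⟩
  (Y + y * Y) + (one + Y)                    ≡⟨ +-comm (Y + y * Y) (one + Y) ⟩
  (one + Y) + (Y + y * Y)                    ≡⟨ +-assoc one Y _ ⟩
  one + (Y + (Y + y * Y))                    ≡⟨ cong (one +_) (+-cancelˡ Y (y * Y)) ⟩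
  one + y * Y                                ∎
  where
  open ≡-Reasoning
  Y : F2[x]
  Y = y ^ suc n

square-+ : ∀ u v → (u + v) * (u + v) ≡ u * u + v * v
square-+ u v = begin
  (u + v) * (u + v)                   ≡⟨ *-distribʳ-+ u v (u + v) ⟩
  u * (u + v) + v * (u + v)           ≡⟨ cong₂ _+_ (*-distribˡ-+ u u v) (*-distribˡ-+ v u v) ⟩
  (u * u + u * v) + (v * u + v * v)   ≡⟨ +-interchange (u * u) (u * v) (v * u) (v * v) ⟩
  (u * u + v * u) + (u * v + v * v)   ≡⟨ cong (λ z → (u * u + z) + (u * v + v * v)) (*-comm v u) ⟩
  (u * u + u * v) + (u * v + v * v)   ≡⟨ +-assoc (u * u) (u * v) _ ⟩
  u * u + (u * v + (u * v + v * v))   ≡⟨ cong (u * u +_) (+-cancelˡ (u * v) (v * v)) ⟩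
  u * u + v * v                       ∎
  where open ≡-Reasoning

frobenius : ∀ y n → (one + y) ^ (2 ^ℕ n) ≡ one + y ^ (2 ^ℕ n)
frobenius y zero    = trans (*-identityʳ (one + y)) (cong (one +_) (sym (*-identityʳ y)))
frobenius y (suc n) = begin
  (one + y) ^ (K ℕ.+ (K ℕ.+ 0))   ≡⟨ cong (λ e → (one + y) ^ (K ℕ.+ e)) (ℕₚ.+-identityʳ K) ⟩
  (one + y) ^ (K ℕ.+ K)           ≡⟨ ^-distribˡ-+-* (one + y) K K ⟩
  (one + y) ^ K * (one + y) ^ K   ≡⟨ cong₂ _*_ (frobenius y n) (frobenius y n) ⟩
  (one + y ^ K) * (one + y ^ K)   ≡⟨ square-+ one (y ^ K) ⟩
  one + y ^ K * y ^ K             ≡⟨ cong (one +_) (^-distribˡ-+-* y K K) ⟨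
  one + y ^ (K ℕ.+ K)             ≡⟨ cong (λ e → one + y ^ (K ℕ.+ e)) (ℕₚ.+-identityʳ K) ⟨
  one + y ^ (K ℕ.+ (K ℕ.+ 0))     ∎
  where
  open ≡-Reasoning
  K : ℕ
  K = 2 ^ℕ n

suc[2^n∸1]≡2^n : ∀ n → suc (2 ^ℕ n ∸ 1) ≡ 2 ^ℕ n
suc[2^n∸1]≡2^n n = ℕₚ.suc-pred (2 ^ℕ n) {{ℕₚ.m^n≢0 2 n}}

geomSum-mersenne : ∀ y n → ¬ one + y ≡ 0p → geomSum y (2 ^ℕ n ∸ 1) ≡ (one + y) ^ (2 ^ℕ n ∸ 1)
geomSum-mersenne y n 1+y≢0 = *-cancelˡ (one + y) _ _ 1+y≢0 (begin
  (one + y) * geomSum y a       ≡⟨ geomSum-telescopes y a ⟩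
  one + y ^ suc a               ≡⟨ cong (λ e → one + y ^ e) (suc[2^n∸1]≡2^n n) ⟩
  one + y ^ (2 ^ℕ n)            ≡⟨ frobenius y n ⟨
  (one + y) ^ (2 ^ℕ n)          ≡⟨ cong ((one + y) ^_) (suc[2^n∸1]≡2^n n) ⟨
  (one + y) * (one + y) ^ a     ∎)
  where
  open ≡-Reasoning
  a : ℕ
  a = 2 ^ℕ n ∸ 1

k+k≢1+j+j : ∀ k j → ¬ k ℕ.+ k ≡ suc (j ℕ.+ j)
k+k≢1+j+j zero    j       ()
k+k≢1+j+j (suc k) zero    e with trans (sym (ℕₚ.+-suc k k)) (ℕₚ.suc-injective e)
... | ()
k+k≢1+j+j (suc k) (suc j) e = k+k≢1+j+j k j
  (ℕₚ.suc-injective (trans (sym (ℕₚ.+-suc k k)) (trans (ℕₚ.suc-injective e) (cong suc (ℕₚ.+-suc j j)))))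

2^[1+n]∸1≡1+j+j : ∀ n → 2 ^ℕ suc n ∸ 1 ≡ suc ((2 ^ℕ n ∸ 1) ℕ.+ (2 ^ℕ n ∸ 1))
2^[1+n]∸1≡1+j+j n = begin
  2 ^ℕ suc n ∸ 1                  ≡⟨ cong (λ K → K ℕ.+ (K ℕ.+ 0) ∸ 1) (suc[2^n∸1]≡2^n n) ⟨
  j ℕ.+ (suc j ℕ.+ 0)             ≡⟨ cong (j ℕ.+_) (ℕₚ.+-identityʳ (suc j)) ⟩
  j ℕ.+ suc j                     ≡⟨ ℕₚ.+-suc j j ⟩
  suc (j ℕ.+ j)                   ∎
  where
  open ≡-Reasoning
  j : ℕ
  j = 2 ^ℕ n ∸ 1

mersenne-notDouble : ∀ n → 1 ≤ n → NotDouble (2 ^ℕ n ∸ 1)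
mersenne-notDouble (suc n) _ k k+k≡ = k+k≢1+j+j k (2 ^ℕ n ∸ 1) (trans k+k≡ (2^[1+n]∸1≡1+j+j n))

X-irreducible : Irreducible X
X-irreducible = deg1⇒irreducible (false ∷⁺ 1p) refl

X+1-irreducible : Irreducible X+1
X+1-irreducible = deg1⇒irreducible (true ∷⁺ 1p) refl

open Monomials X-irreducible X+1-irreducible (λ ()) using (σ**-mono)

-- Here 1 + x = x + 1 and 1 + (x + 1) = x, so σ** is (x + 1)^a x^b.
σ**-mersenne-splits : ∀ n m → 1 ≤ n → 1 ≤ m → Splits (σ** (X ^ (2 ^ℕ n ∸ 1) * X+1 ^ (2 ^ℕ m ∸ 1)))
σ**-mersenne-splits n m n≥1 m≥1 =
  subst Splits (sym σ**≡) (*-splits (^-splits refl (2 ^ℕ n ∸ 1)) (^-splits refl (2 ^ℕ m ∸ 1)))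
  where
  σ**≡ : σ** (X ^ (2 ^ℕ n ∸ 1) * X+1 ^ (2 ^ℕ m ∸ 1)) ≡ X+1 ^ (2 ^ℕ n ∸ 1) * X ^ (2 ^ℕ m ∸ 1)
  σ**≡ = trans (σ**-mono (mersenne-notDouble n n≥1) (mersenne-notDouble m m≥1))
               (cong₂ _*_ (geomSum-mersenne X n (λ ())) (geomSum-mersenne X+1 m (λ ())))

-- σ** evaluated: x(x+1) ↦ (x+1)x, x(x+1)² ↦ (x+1)x², x²(x+1) ↦ (x+1)²x, x²(x+1)² ↦ (x+1)²x².
σ**-small-splits : ∀ a b → 1 ≤ a → 1 ≤ b → a < 3 → b < 3 → Splits (σ** (X ^ a * X+1 ^ b))
σ**-small-splits 1 1 _ _ _ _ = X+1 ∷ X ∷ []             , refl ∷ refl ∷ []               , refl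
σ**-small-splits 1 2 _ _ _ _ = X+1 ∷ X ∷ X ∷ []         , refl ∷ refl ∷ refl ∷ []        , refl
σ**-small-splits 2 1 _ _ _ _ = X+1 ∷ X+1 ∷ X ∷ []       , refl ∷ refl ∷ refl ∷ []        , refl
σ**-small-splits 2 2 _ _ _ _ = X+1 ∷ X+1 ∷ X ∷ X ∷ []   , refl ∷ refl ∷ refl ∷ refl ∷ [] , refl
σ**-small-splits (suc (suc (suc _))) _ _ _ (s≤s (s≤s (s≤s ()))) _
σ**-small-splits (suc _) (suc (suc (suc _))) _ _ _ (s≤s (s≤s (s≤s ())))

lemma3p1 : (a b c : ℕ) (P : F2[x]) →
    1 ≤ a → 1 ≤ b → 1 ≤ c → Odd P → Irreducible P →
    BiUnitaryPerfect (X ^ a * X+1 ^ b * P ^ c) →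
    ¬ Splits (σ** (X ^ a * X+1 ^ b))
    × (3 ≤ a ⊎ 3 ≤ b)
    × ¬ (∃ λ n → ∃ λ m → 1 ≤ n × 1 ≤ m × a ≡ 2 ^ℕ n ∸ 1 × b ≡ 2 ^ℕ m ∸ 1)
lemma3p1 a b (suc c) P a≥1 b≥1 _ P-odd P-irr perfect = ¬splits , large-exponent , ¬mersenne
  where
  B : F2[x]
  B = X ^ a * X+1 ^ b

  P∣σ**B : P ∣ σ** B
  P∣σ**B = ∣-+ʳ P (subst (P ∣_) (sym perfect) (∣-*ˡ P B (P ^ c , refl)))
                  (σ**-*^-≡-mod P-irr B (suc c) (*-≢0 (^-≢0 (λ ()) a) (^-≢0 (λ ()) b)))

  ¬splits : ¬ Splits (σ** B)
  ¬splits = odd-irreducible∣⇒¬Splits P-odd P-irr (σ** B) P∣σ**B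

  large-exponent : 3 ≤ a ⊎ 3 ≤ b
  large-exponent with 3 ℕ.≤? a | 3 ℕ.≤? b
  ... | yes 3≤a | _       = inj₁ 3≤a
  ... | no _    | yes 3≤b = inj₂ 3≤b
  ... | no 3≰a  | no 3≰b  = ⊥-elim (¬splits (σ**-small-splits a b a≥1 b≥1 (ℕₚ.≰⇒> 3≰a) (ℕₚ.≰⇒> 3≰b)))

  ¬mersenne : ¬ (∃ λ n → ∃ λ m → 1 ≤ n × 1 ≤ m × a ≡ 2 ^ℕ n ∸ 1 × b ≡ 2 ^ℕ m ∸ 1)
  ¬mersenne (n , m , n≥1 , m≥1 , refl , refl) = ¬splits (σ**-mersenne-splits n m n≥1 m≥1)
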